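{- Let $d=p^2+4q$. For all non-negative integers $n$ and $k$, $$\sum_{j=0}^{n}\binom{n}{j}q^{n-j}W_{2j+k}=\begin{cases} d^{\frac{n}{2}}W_{n+k}, & \text{if } n \text{ is even};\\ d^{\frac{n-1}{2}}\left(W_{n+k+1}+qW_{n+k-1}\right), & \text{if } n \text{ is odd}.\end{cases}$$
   Context: Let $H$ be the real quaternion algebra with basis $1,i,j,k$ and (non-commutative) multiplication determined by $i^2=j^2=k^2=-1$, $ij=-ji=k$, $jk=-kj=i$, $ki=-ik=j$; real scalars commute with all quaternions. Fix real numbers $p,q$. The Horadam sequence $w_n=w_n(w_0,w_1;p,q)$ has real initial values $w_0,w_1$ and satisfies $w_n=pw_{n-1}+qw_{n-2}$ for $n\ge 2$. The Horadam quaternions are $W_n=w_n+w_{n+1}i+w_{n+2}j+w_{n+3}k$. -}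

module Defs where

open import Level using (Level)
open import Data.Nat using (ℕ; zero; suc)
open import Data.Nat.Combinatorics using (_C_)
open import Algebra.Bundles using (CommutativeRing)

-- Everything is developed over an arbitrary commutative ring R of scalars
-- (the paper uses R = ℝ, which the Agda standard library does not provide).
module Horadam {c ℓ : Level} (R : CommutativeRing c ℓ) where
  open CommutativeRing R hiding (zero)

  fromℕ : ℕ → Carrier
  fromℕ zero    = 0#
  fromℕ (suc n) = 1# + fromℕ n

  pow : Carrier → ℕ → Carrier
  pow x zero    = 1#
  pow x (suc n) = x * pow x n

  w : (w0 w1 p q : Carrier) → ℕ → Carrier
  w w0 w1 p q zero          = w0
  w w0 w1 p q (suc zero)    = w1
  w w0 w1 p q (suc (suc n)) = p * w w0 w1 p q (suc n) + q * w w0 w1 p q n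

  record Quaternion : Set c where
    constructor quat
    field
      re ci cj ck : Carrier
  open Quaternion public

  _≈Q_ : Quaternion → Quaternion → Set ℓ
  a ≈Q b = (re a ≈ re b) × (ci a ≈ ci b) × (cj a ≈ cj b) × (ck a ≈ ck b)
    where open import Data.Product using (_×_)

  0Q : Quaternion
  0Q = quat 0# 0# 0# 0#

  _+Q_ : Quaternion → Quaternion → Quaternion
  a +Q b = quat (re a + re b) (ci a + ci b) (cj a + cj b) (ck a + ck b)

  _·Q_ : Carrier → Quaternion → Quaternion
  s ·Q a = quat (s * re a) (s * ci a) (s * cj a) (s * ck a)

  -- Hamilton product (i² = j² = k² = -1, ij = k, jk = i, ki = j)
  _*Q_ : Quaternion → Quaternion → Quaternion
  a *Q b = quat
    (re a * re b - ci a * ci b - cj a * cj b - ck a * ck b)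
    (re a * ci b + ci a * re b + cj a * ck b - ck a * cj b)
    (re a * cj b - ci a * ck b + cj a * re b + ck a * ci b)
    (re a * ck b + ci a * cj b - cj a * ci b + ck a * re b)

  W : (w0 w1 p q : Carrier) → ℕ → Quaternion
  W w0 w1 p q n = quat (w w0 w1 p q n) (w w0 w1 p q (suc n))
                       (w w0 w1 p q (suc (suc n))) (w w0 w1 p q (suc (suc (suc n))))

  sumQ≤ : ℕ → (ℕ → Quaternion) → Quaternion
  sumQ≤ zero    f = f zero
  sumQ≤ (suc n) f = sumQ≤ n f +Q f (suc n)

  disc : (p q : Carrier) → Carrier
  disc p q = p * p + fromℕ 4 * q

module Submission where

-- Write B_n g = Σ_{j≤n} C(n,j) q^{n-j} g(j) for the q-binomial
-- transform of a scalar sequence g.  Pascal's rule gives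
--   B_{n+1} g = q·B_n g + B_n (g ∘ suc),
-- so the sums S_n u k = B_n (j ↦ u(2j+k)) satisfy S_{n+1} u = T (S_n u), where
-- T u k = q·u(k) + u(k+2); that is, S_n u = Tⁿ u.  For every sequence u with
-- u(k+2) = p·u(k+1) + q·u(k) one checks the quadratic relation
--   T (T u) k = d·u(k+2),   d = p² + 4q,
-- and since scaled and shifted solutions of the recurrence are again solutions,
-- induction gives S_{2m} u k = d^m u(2m+k), and one more application of T the
-- odd case.

open import Defs
open import Level using (Level)
open import Data.Nat using (ℕ)
import Data.Nat as ℕ
open import Data.Nat.DivMod using (_/_; _%_)
open import Data.Nat.Combinatorics using (_C_)
open import Algebra.Bundles using (CommutativeRing)
open import Relation.Binary.PropositionalEquality using (_≡_)
open import Data.Product using (_×_)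

open import Data.Nat using (zero; suc)
open import Data.Product using (_,_)
open import Data.Sum using (inj₁; inj₂)
import Data.Nat.Properties as ℕP
import Data.Nat.DivMod as ℕD
open import Data.Nat.Combinatorics using (nCk+nC[k+1]≡[n+1]C[k+1]; k>n⇒nCk≡0)
import Relation.Binary.PropositionalEquality as ≡
import Algebra.Properties.CommutativeSemigroup as CommSemigroupProperties
import Algebra.Solver.Ring.NaturalCoefficients.Default as NatCoeffSolver

+-suc-suc : ∀ a k → a ℕ.+ suc (suc k) ≡ suc (suc (a ℕ.+ k))
+-suc-suc a k = ≡.trans (ℕP.+-suc a (suc k)) (≡.cong suc (ℕP.+-suc a k))

even-half : ∀ n → n % 2 ≡ 0 → n / 2 ℕ.* 2 ≡ n
even-half n h = ≡.sym (≡.trans (ℕD.m≡m%n+[m/n]*n n 2) (≡.cong (ℕ._+ n / 2 ℕ.* 2) h))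

odd-half : ∀ n → n % 2 ≡ 1 → suc (n / 2 ℕ.* 2) ≡ n
odd-half n h = ≡.sym (≡.trans (ℕD.m≡m%n+[m/n]*n n 2) (≡.cong (ℕ._+ n / 2 ℕ.* 2) h))

module Development {c ℓ : Level} (R : CommutativeRing c ℓ) where
  open CommutativeRing R hiding (zero)
  open Horadam R
  open CommSemigroupProperties +-commutativeSemigroup using (interchange)
  open NatCoeffSolver commutativeSemiring using (solve; _:+_; _:*_; _:=_; con)
  open import Relation.Binary.Reasoning.Setoid setoid

  sum : ℕ → (ℕ → Carrier) → Carrier
  sum zero    f = f zero
  sum (suc n) f = sum n f + f (suc n)

  sum-cong : ∀ n {f g : ℕ → Carrier} → (∀ j → f j ≈ g j) → sum n f ≈ sum n g
  sum-cong zero    f≈g = f≈g zero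
  sum-cong (suc n) f≈g = +-cong (sum-cong n f≈g) (f≈g (suc n))

  sum-+ : ∀ n (f g : ℕ → Carrier) → sum n (λ j → f j + g j) ≈ sum n f + sum n g
  sum-+ zero    f g = refl
  sum-+ (suc n) f g = trans (+-congʳ (sum-+ n f g)) (interchange _ _ _ _)

  sum-*ˡ : ∀ n a (f : ℕ → Carrier) → a * sum n f ≈ sum n (λ j → a * f j)
  sum-*ˡ zero    a f = refl
  sum-*ˡ (suc n) a f = trans (distribˡ a _ _) (+-congʳ (sum-*ˡ n a f))

  sum-unfoldˡ : ∀ n (f : ℕ → Carrier) → sum (suc n) f ≈ f 0 + sum n (λ j → f (suc j))
  sum-unfoldˡ zero    f = refl
  sum-unfoldˡ (suc n) f = trans (+-congʳ (sum-unfoldˡ n f)) (+-assoc _ _ _)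

  fromℕ-+ : ∀ a b → fromℕ (a ℕ.+ b) ≈ fromℕ a + fromℕ b
  fromℕ-+ zero    b = sym (+-identityˡ _)
  fromℕ-+ (suc a) b = trans (+-congˡ (fromℕ-+ a b)) (sym (+-assoc _ _ _))

  module BinomialTransform (q : Carrier) where

    coeff : ℕ → ℕ → Carrier
    coeff n j = fromℕ (n C j) * pow q (n ℕ.∸ j)

    B : ℕ → (ℕ → Carrier) → Carrier
    B n g = sum n (λ j → coeff n j * g j)

    B-cong : ∀ n {f g : ℕ → Carrier} → (∀ j → f j ≈ g j) → B n f ≈ B n g
    B-cong n f≈g = sum-cong n (λ j → *-congˡ (f≈g j))

    coeff-beyond : ∀ n → coeff n (suc n) ≈ 0#
    coeff-beyond n = begin
      fromℕ (n C suc n) * pow q (n ℕ.∸ suc n)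
        ≡⟨ ≡.cong (λ t → fromℕ t * pow q (n ℕ.∸ suc n)) (k>n⇒nCk≡0 (ℕP.n<1+n n)) ⟩
      0# * pow q (n ℕ.∸ suc n)
        ≈⟨ zeroˡ _ ⟩
      0# ∎

    coeff-first : ∀ n → coeff (suc n) 0 ≈ q * coeff n 0
    coeff-first n = solve 3 (λ x q y → x :* (q :* y) := q :* (x :* y)) refl
                      (fromℕ (n C 0)) q (pow q n)

    -- Pascal's rule for the weights.  When j ≥ n the last weight is zero on
    -- both sides, otherwise q·q^{n-j-1} = q^{n-j}.
    coeff-pascal : ∀ n j → coeff (suc n) (suc j) ≈ coeff n j + q * coeff n (suc j)
    coeff-pascal n j = begin
      fromℕ (suc n C suc j) * Q
        ≡⟨ ≡.cong (λ t → fromℕ t * Q) (≡.sym (nCk+nC[k+1]≡[n+1]C[k+1] n j)) ⟩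
      fromℕ (n C j ℕ.+ n C suc j) * Q
        ≈⟨ trans (*-congʳ (fromℕ-+ (n C j) (n C suc j))) (distribʳ Q _ _) ⟩
      coeff n j + fromℕ (n C suc j) * Q
        ≈⟨ +-congˡ upper ⟩
      coeff n j + q * coeff n (suc j) ∎
      where
      Q : Carrier
      Q = pow q (n ℕ.∸ j)
      upper : fromℕ (n C suc j) * Q ≈ q * coeff n (suc j)
      upper with ℕP.<-≤-connex j n
      ... | inj₁ j<n = begin
        fromℕ (n C suc j) * Q
          ≡⟨ ≡.cong (λ t → fromℕ (n C suc j) * pow q t) (ℕP.+-∸-assoc 1 j<n) ⟩
        fromℕ (n C suc j) * (q * pow q (n ℕ.∸ suc j))
          ≈⟨ solve 3 (λ x q y → x :* (q :* y) := q :* (x :* y)) refl _ q _ ⟩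
        q * coeff n (suc j) ∎
      ... | inj₂ n≤j = begin
        fromℕ (n C suc j) * Q    ≡⟨ ≡.cong (λ t → fromℕ t * Q) vanish ⟩
        0# * Q                   ≈⟨ zeroˡ Q ⟩
        0#                       ≈⟨ zeroʳ q ⟨
        q * 0#                   ≈⟨ *-congˡ (zeroˡ _) ⟨
        q * (0# * _)             ≡⟨ ≡.cong (λ t → q * (fromℕ t * pow q (n ℕ.∸ suc j))) (≡.sym vanish) ⟩
        q * coeff n (suc j)      ∎
        where
        vanish : n C suc j ≡ 0
        vanish = k>n⇒nCk≡0 (ℕ.s≤s n≤j)

    -- B_n g written with its first term split off, the sum running one index
    -- further (the extra weight vanishes).
    B-unfoldˡ : ∀ n g → B n g ≈ coeff n 0 * g 0 + sum n (λ j → coeff n (suc j) * g (suc j))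
    B-unfoldˡ n g = begin
      B n g                                          ≈⟨ +-identityʳ _ ⟨
      B n g + 0#                                     ≈⟨ +-congˡ (trans (*-congʳ (coeff-beyond n)) (zeroˡ _)) ⟨
      B n g + coeff n (suc n) * g (suc n)            ≈⟨ sum-unfoldˡ n (λ j → coeff n j * g j) ⟩
      coeff n 0 * g 0 + sum n (λ j → coeff n (suc j) * g (suc j)) ∎

    B-pascal : ∀ n g → B (suc n) g ≈ q * B n g + B n (λ j → g (suc j))
    B-pascal n g = begin
      B (suc n) g
        ≈⟨ sum-unfoldˡ n (λ j → coeff (suc n) j * g j) ⟩
      coeff (suc n) 0 * g 0 + sum n (λ j → coeff (suc n) (suc j) * g (suc j))
        ≈⟨ +-cong (*-congʳ (coeff-first n)) (sum-cong n split) ⟩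
      q * coeff n 0 * g 0 + sum n (λ j → coeff n j * g (suc j) + q * Tail j)
        ≈⟨ +-congˡ (trans (sum-+ n _ _) (+-congˡ (sym (sum-*ˡ n q Tail)))) ⟩
      q * coeff n 0 * g 0 + (B n (λ j → g (suc j)) + q * sum n Tail)
        ≈⟨ solve 5 (λ a x y b s → a :* x :* y :+ (b :+ a :* s) := a :* (x :* y :+ s) :+ b)
                 refl q (coeff n 0) (g 0) (B n (λ j → g (suc j))) (sum n Tail) ⟩
      q * (coeff n 0 * g 0 + sum n Tail) + B n (λ j → g (suc j))
        ≈⟨ +-congʳ (*-congˡ (B-unfoldˡ n g)) ⟨
      q * B n g + B n (λ j → g (suc j)) ∎
      where
      Tail : ℕ → Carrier
      Tail j = coeff n (suc j) * g (suc j)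
      split : ∀ j → coeff (suc n) (suc j) * g (suc j) ≈ coeff n j * g (suc j) + q * Tail j
      split j = trans (*-congʳ (coeff-pascal n j)) (trans (distribʳ _ _ _) (+-congˡ (*-assoc _ _ _)))

  module Recurrence (p q : Carrier) where
    open BinomialTransform q

    Recurrent : (ℕ → Carrier) → Set ℓ
    Recurrent u = ∀ k → u (suc (suc k)) ≈ p * u (suc k) + q * u k

    scale-recurrent : ∀ {u} → Recurrent u → ∀ a → Recurrent (λ k → a * u k)
    scale-recurrent {u} rec a k = begin
      a * u (suc (suc k))               ≈⟨ *-congˡ (rec k) ⟩
      a * (p * u (suc k) + q * u k)     ≈⟨ solve 5 (λ a p x q y → a :* (p :* x :+ q :* y)
                                                   := p :* (a :* x) :+ q :* (a :* y))
                                                 refl a p (u (suc k)) q (u k) ⟩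
      p * (a * u (suc k)) + q * (a * u k) ∎

    shift-recurrent : ∀ {u} → Recurrent u → ∀ i → Recurrent (λ k → u (i ℕ.+ k))
    shift-recurrent rec zero    = rec
    shift-recurrent rec (suc i) = shift-recurrent (λ k → rec (suc k)) i

    d : Carrier
    d = disc p q

    -- The operator T u k = q·u(k) + u(k+2); the sums S_n below are Tⁿ u.
    T : (ℕ → Carrier) → ℕ → Carrier
    T u k = q * u k + u (suc (suc k))

    T-cong : ∀ {f g : ℕ → Carrier} → (∀ j → f j ≈ g j) → ∀ k → T f k ≈ T g k
    T-cong f≈g k = +-cong (*-congˡ (f≈g k)) (f≈g (suc (suc k)))

    -- Everything is expressed through
    -- a = u(k) and b = u(k+1), where it is a polynomial identity; the constant
    -- 4 is written 1+(1+(1+(1+0))) so that it is literally fromℕ 4 in disc.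
    T-square : ∀ {u} → Recurrent u → ∀ k → T (T u) k ≈ d * u (suc (suc k))
    T-square {u} rec k = begin
      q * (q * a + u2) + (q * u2 + u (suc (suc (suc (suc k)))))
        ≈⟨ +-cong (*-congˡ (+-congˡ (rec k))) (+-cong (*-congˡ (rec k)) u4≈) ⟩
      q * (q * a + c₂) + (q * c₂ + (p * (p * c₂ + q * b) + q * c₂))
        ≈⟨ solve 4 (λ p q a b →
             q :* (q :* a :+ (p :* b :+ q :* a))
               :+ (q :* (p :* b :+ q :* a)
                 :+ (p :* (p :* (p :* b :+ q :* a) :+ q :* b) :+ q :* (p :* b :+ q :* a)))
             := (p :* p :+ (con 1 :+ (con 1 :+ (con 1 :+ (con 1 :+ con 0)))) :* q)
                  :* (p :* b :+ q :* a))
           refl p q a b ⟩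
      d * c₂
        ≈⟨ *-congˡ (rec k) ⟨
      d * u2 ∎
      where
      a b u2 c₂ : Carrier
      a = u k
      b = u (suc k)
      u2 = u (suc (suc k))
      c₂ = p * b + q * a
      u3≈ : u (suc (suc (suc k))) ≈ p * c₂ + q * b
      u3≈ = trans (rec (suc k)) (+-congʳ (*-congˡ (rec k)))
      u4≈ : u (suc (suc (suc (suc k)))) ≈ p * (p * c₂ + q * b) + q * c₂
      u4≈ = trans (rec (suc (suc k))) (+-cong (*-congˡ u3≈) (*-congˡ (rec k)))

    S : ℕ → (ℕ → Carrier) → ℕ → Carrier
    S n u k = B n (λ j → u (2 ℕ.* j ℕ.+ k))

    S-step : ∀ n u k → S (suc n) u k ≈ T (S n u) k
    S-step n u k = trans (B-pascal n _) (+-congˡ (B-cong n (λ j → reflexive (≡.cong u (index j)))))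
      where
      index : ∀ j → 2 ℕ.* suc j ℕ.+ k ≡ 2 ℕ.* j ℕ.+ suc (suc k)
      index j = ≡.trans (≡.cong (ℕ._+ k) (ℕP.*-suc 2 j)) (≡.sym (+-suc-suc (2 ℕ.* j) k))

    -- Even closed form S_{2m} u k = d^m u(2m+k): apply T-square to the
    -- solution j ↦ d^m u(2m+j) provided by the induction hypothesis.
    S-even : ∀ {u} → Recurrent u → ∀ m k → S (m ℕ.* 2) u k ≈ pow d m * u (m ℕ.* 2 ℕ.+ k)
    S-even     rec zero    k = *-congʳ (trans (*-identityʳ _) (+-identityʳ _))
    S-even {u} rec (suc m) k = begin
      S (suc (suc m₂)) u k                ≈⟨ S-step (suc m₂) u k ⟩
      T (S (suc m₂) u) k                  ≈⟨ T-cong (S-step m₂ u) k ⟩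
      T (T (S m₂ u)) k                    ≈⟨ T-cong (T-cong (S-even rec m)) k ⟩
      T (T v) k                           ≈⟨ T-square (scale-recurrent (shift-recurrent rec m₂) (pow d m)) k ⟩
      d * (pow d m * u (m₂ ℕ.+ suc (suc k))) ≡⟨ ≡.cong (λ i → d * (pow d m * u i)) (+-suc-suc m₂ k) ⟩
      d * (pow d m * u (suc (suc (m₂ ℕ.+ k)))) ≈⟨ *-assoc d _ _ ⟨
      pow d (suc m) * u (suc (suc m₂) ℕ.+ k) ∎
      where
      m₂ : ℕ
      m₂ = m ℕ.* 2
      v : ℕ → Carrier
      v j = pow d m * u (m₂ ℕ.+ j)

    S-odd : ∀ {u} → Recurrent u → ∀ m k →
            S (suc (m ℕ.* 2)) u k ≈ pow d m * (u (suc (suc (m ℕ.* 2 ℕ.+ k))) + q * u (m ℕ.* 2 ℕ.+ k))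
    S-odd {u} rec m k = begin
      S (suc m₂) u k                                ≈⟨ S-step m₂ u k ⟩
      T (S m₂ u) k                                  ≈⟨ T-cong (S-even rec m) k ⟩
      q * (D * u (m₂ ℕ.+ k)) + D * u (m₂ ℕ.+ suc (suc k))
        ≡⟨ ≡.cong (λ i → q * (D * u (m₂ ℕ.+ k)) + D * u i) (+-suc-suc m₂ k) ⟩
      q * (D * u (m₂ ℕ.+ k)) + D * u (suc (suc (m₂ ℕ.+ k)))
        ≈⟨ solve 4 (λ q D a b → q :* (D :* a) :+ D :* b := D :* (b :+ q :* a))
                 refl q D (u (m₂ ℕ.+ k)) (u (suc (suc (m₂ ℕ.+ k)))) ⟩
      D * (u (suc (suc (m₂ ℕ.+ k))) + q * u (m₂ ℕ.+ k)) ∎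
      where
      m₂ : ℕ
      m₂ = m ℕ.* 2
      D : Carrier
      D = pow d m

    binomial-even : ∀ {u} → Recurrent u → ∀ n k → n % 2 ≡ 0 →
                    S n u k ≈ pow d (n / 2) * u (n ℕ.+ k)
    binomial-even {u} rec n k h =
      ≡.subst (λ t → S t u k ≈ pow d (n / 2) * u (t ℕ.+ k)) (even-half n h) (S-even rec (n / 2) k)

    binomial-odd : ∀ {u} → Recurrent u → ∀ n k → n % 2 ≡ 1 →
                   S n u k ≈ pow d ((n ℕ.∸ 1) / 2) * (u (n ℕ.+ k ℕ.+ 1) + q * u (n ℕ.+ k ℕ.∸ 1))
    binomial-odd {u} rec n k h =
      ≡.subst (λ t → S t u k ≈ pow d ((t ℕ.∸ 1) / 2) * (u (t ℕ.+ k ℕ.+ 1) + q * u (t ℕ.+ k ℕ.∸ 1)))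
              (odd-half n h) reindexed
      where
      m m₂ : ℕ
      m = n / 2
      m₂ = m ℕ.* 2
      reindexed : S (suc m₂) u k ≈ pow d (m₂ / 2) * (u (suc m₂ ℕ.+ k ℕ.+ 1) + q * u (m₂ ℕ.+ k))
      reindexed = trans (S-odd rec m k)
        (reflexive (≡.cong₂ (λ e i → pow d e * (u i + q * u (m₂ ℕ.+ k)))
                            (≡.sym (ℕD.m*n/n≡m m 2)) (ℕP.+-comm 1 (suc (m₂ ℕ.+ k)))))

  coordinate-sum : (π : Quaternion → Carrier) → (∀ a b → π (a +Q b) ≡ π a + π b) →
                   ∀ n f → π (sumQ≤ n f) ≈ sum n (λ j → π (f j))
  coordinate-sum π additive zero    f = refl
  coordinate-sum π additive (suc n) f =
    trans (reflexive (additive _ _)) (+-congʳ (coordinate-sum π additive n f))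

  module HoradamQuaternions (p q w0 w1 : Carrier) where
    open BinomialTransform q
    open Recurrence p q

    horadam-recurrent : Recurrent (w w0 w1 p q)
    horadam-recurrent k = refl

    -- An additive coordinate functional reading W_x as the Horadam number
    -- w_{offset+x}; the four quaternion components are such coordinates.
    record Coordinate : Set c where
      field
        π        : Quaternion → Carrier
        offset   : ℕ
        additive : ∀ a b → π (a +Q b) ≡ π a + π b
        on-W     : ∀ a x → π (a ·Q W w0 w1 p q x) ≡ a * w w0 w1 p q (offset ℕ.+ x)
    open Coordinate public

    re-coordinate ci-coordinate cj-coordinate ck-coordinate : Coordinate
    re-coordinate = record { π = re ; offset = 0 ; additive = λ _ _ → ≡.refl ; on-W = λ _ _ → ≡.refl }
    ci-coordinate = record { π = ci ; offset = 1 ; additive = λ _ _ → ≡.refl ; on-W = λ _ _ → ≡.refl }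
    cj-coordinate = record { π = cj ; offset = 2 ; additive = λ _ _ → ≡.refl ; on-W = λ _ _ → ≡.refl }
    ck-coordinate = record { π = ck ; offset = 3 ; additive = λ _ _ → ≡.refl ; on-W = λ _ _ → ≡.refl }

    Sum : ℕ → ℕ → Quaternion
    Sum n k = sumQ≤ n (λ j → coeff n j ·Q W w0 w1 p q (2 ℕ.* j ℕ.+ k))

    along : Coordinate → ℕ → Carrier
    along κ x = w w0 w1 p q (offset κ ℕ.+ x)

    along-recurrent : ∀ κ → Recurrent (along κ)
    along-recurrent κ = shift-recurrent horadam-recurrent (offset κ)

    coordinate-reduction : ∀ κ n k → π κ (Sum n k) ≈ S n (along κ) k
    coordinate-reduction κ n k =
      trans (coordinate-sum (π κ) (additive κ) n _) (sum-cong n (λ j → reflexive (on-W κ _ _)))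

    coordinate-even : ∀ κ n k → n % 2 ≡ 0 →
                      π κ (Sum n k) ≈ pow d (n / 2) * along κ (n ℕ.+ k)
    coordinate-even κ n k h =
      trans (coordinate-reduction κ n k) (binomial-even (along-recurrent κ) n k h)

    coordinate-odd : ∀ κ n k → n % 2 ≡ 1 →
                     π κ (Sum n k) ≈ pow d ((n ℕ.∸ 1) / 2)
                                     * (along κ (n ℕ.+ k ℕ.+ 1) + q * along κ (n ℕ.+ k ℕ.∸ 1))
    coordinate-odd κ n k h =
      trans (coordinate-reduction κ n k) (binomial-odd (along-recurrent κ) n k h)

theorem3p3 : ∀ {c ℓ : Level} (R : CommutativeRing c ℓ) →
    let open CommutativeRing R hiding (zero)
        open Horadam R
    in (p q w0 w1 : Carrier) (n k : ℕ) →
       let d = disc p q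
           Wn = W w0 w1 p q
           S = sumQ≤ n (λ j → (fromℕ (n C j) * pow q (n ℕ.∸ j)) ·Q Wn (2 ℕ.* j ℕ.+ k))
       in (n % 2 ≡ 0 → S ≈Q (pow d (n / 2) ·Q Wn (n ℕ.+ k)))
        × (n % 2 ≡ 1 → S ≈Q (pow d ((n ℕ.∸ 1) / 2) ·Q (Wn (n ℕ.+ k ℕ.+ 1) +Q (q ·Q Wn (n ℕ.+ k ℕ.∸ 1)))))
theorem3p3 R p q w0 w1 n k =
    (λ h → coordinate-even re-coordinate n k h , coordinate-even ci-coordinate n k h
         , coordinate-even cj-coordinate n k h , coordinate-even ck-coordinate n k h)
  , (λ h → coordinate-odd re-coordinate n k h , coordinate-odd ci-coordinate n k h
         , coordinate-odd cj-coordinate n k h , coordinate-odd ck-coordinate n k h)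
  where
  open Development R
  open HoradamQuaternions p q w0 w1
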